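{- Let $k\ge 2$, and let $\ell=2k-2$ if $k$ is odd and $\ell=2k-1$ if $k$ is even. Then the Fibonacci digraph $F(2,k)$ contains a cycle of every length $1,2,\ldots,\ell$.
   Context: $F(2,k)$ has as vertices all binary words $x_1\ldots x_k$ with no two consecutive $1$'s, and an arc from $x_1x_2\ldots x_k$ to $x_2\ldots x_kx_{k+1}$ whenever $x_1\ldots x_{k+1}$ has no two consecutive $1$'s (so $00\ldots0$ has a loop). A cycle is a closed walk whose vertices are all distinct; a loop is a cycle of length $1$. -}

module Defs where

open import Data.Bool using (Bool; true; false)
open import Data.Nat using (ℕ; zero; suc; _+_; _*_; _∸_; _≤_)
open import Data.Nat.Properties using (_≟_)
open import Data.Fin using (Fin; toℕ; fromℕ<)
open import Data.Nat.DivMod using (_%_; m%n<n)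
open import Data.Vec using (Vec; []; _∷_; _∷ʳ_)
open import Data.Product using (Σ; _×_)
open import Data.Empty using (⊥)
open import Data.Unit using (⊤)
open import Relation.Binary.PropositionalEquality using (_≡_)
open import Function.Definitions using (Injective)

NoConsec : ∀ {n} → Vec Bool n → Set
NoConsec [] = ⊤
NoConsec (x ∷ []) = ⊤
NoConsec (true ∷ true ∷ xs) = ⊥
NoConsec (x ∷ y ∷ xs) = NoConsec (y ∷ xs)

Vertex : ℕ → Set
Vertex k = Σ (Vec Bool k) NoConsec

Arc : ∀ {k} → Vertex k → Vertex k → Set
Arc {zero} _ _ = ⊥
Arc {suc k} (x ∷ xs Data.Product., _) (w Data.Product., _) =
  Σ Bool (λ b → NoConsec ((x ∷ xs) ∷ʳ b) × (w ≡ xs ∷ʳ b))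

next : ∀ {n} → Fin n → Fin n
next {suc n} i = fromℕ< (m%n<n (suc (toℕ i)) (suc n))

record Cycle (k n : ℕ) : Set where
  field
    vert      : Fin n → Vertex k
    nonempty  : 1 ≤ n
    distinct  : Injective _≡_ _≡_ vert
    arcs      : ∀ i → Arc (vert i) (vert (next i))

ell : ℕ → ℕ
ell k with k % 2
... | 0 = 2 * k ∸ 1
... | _ = 2 * k ∸ 2

-- A closed walk of length N in F(2,k) is the same thing as an N-periodic binary
-- sequence without two consecutive 1's: the vertices are its windows of length k
-- at the start positions 0, …, N-1.  The walk is a cycle as soon as these N
-- windows are pairwise distinct, and distinctness of the k-windows implies
-- distinctness of the longer ones.  So the theorem reduces to exhibiting, for
-- each n, a periodic sequence with distinct windows of some length ≤ k.
--
-- For n = 1 this is the zero sequence.  For n ≥ 2 we use the necklace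
-- (10)^j 1 0^(m+1), of length N = 2j + m + 2: when m+1 ≤ k ≤ m+2 and 2j+2 ≤ k,
-- a k-window determines its start position, being located either by its first 1
-- (which is then the 1 at position N) or by its last 1 (which then sits at cyclic
-- position 2j).  Window length k = n with j = 0 gives every 2 ≤ n ≤ k, and
-- splitting n - k = 2j or 2j+1 gives every k ≤ n ≤ ℓ, since ℓ = k + 2c + 1 with
-- 2c ≤ k - 2.
module Submission where

open import Defs
open import Data.Bool using (Bool; true; false)
open import Data.Maybe using (Maybe; just; nothing)
open import Data.Nat
  using (ℕ; zero; suc; _+_; _*_; _∸_; _≤_; _<_; z≤n; s≤s; s≤s⁻¹; _≤′_; ≤′-refl; ≤′-step; _≤?_)
open import Data.Nat.Properties
open import Data.Nat.DivMod
  using (_%_; _/_; n%n≡0; m<n⇒m%n≡m; [m+n]%n≡m%n; [m+kn]%n≡m%n; m≡m%n+[m/n]*n; m*n%n≡0)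
open import Data.Fin using (Fin; toℕ)
open import Data.Fin.Properties using (toℕ-injective; toℕ<n; toℕ-fromℕ<)
open import Data.Vec using (Vec; []; _∷_; _∷ʳ_)
open import Data.Vec.Properties using (∷ʳ-injectiveˡ)
open import Data.Product using (Σ; _,_; proj₁; _×_)
open import Data.Sum using (_⊎_; inj₁; inj₂)
open import Data.Unit using (tt)
open import Relation.Binary.PropositionalEquality
  using (_≡_; refl; sym; trans; cong; cong₂; subst; module ≡-Reasoning)
open import Relation.Nullary using (yes; no)
open import Function.Definitions using (Injective)

open ≡-Reasoning

window : (ℕ → Bool) → (k : ℕ) → ℕ → Vec Bool k
window f zero    x = []
window f (suc k) x = f x ∷ window f k (suc x)

shifted : ∀ (f : ℕ → Bool) t x → f (t + suc x) ≡ f (suc t + x)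
shifted f t x = cong f (+-suc t x)

window-cong : ∀ f k x y → (∀ t → f (t + x) ≡ f (t + y)) → window f k x ≡ window f k y
window-cong f zero    x y same = refl
window-cong f (suc k) x y same = cong₂ _∷_ (same 0) (window-cong f k (suc x) (suc y) same′)
  where
  same′ : ∀ t → f (t + suc x) ≡ f (t + suc y)
  same′ t = trans (shifted f t x) (trans (same (suc t)) (sym (shifted f t y)))

window-snoc : ∀ f k x → window f (suc k) x ≡ window f k x ∷ʳ f (k + x)
window-snoc f zero    x = refl
window-snoc f (suc k) x =
  cong (f x ∷_) (trans (window-snoc f k (suc x)) (cong (window f k (suc x) ∷ʳ_) (shifted f k x)))

NoConsecutiveOnes : (ℕ → Bool) → Set
NoConsecutiveOnes f = ∀ y → f y ≡ true → f (suc y) ≡ false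

noConsec-cons : ∀ {l} a b (w : Vec Bool l) →
                (a ≡ true → b ≡ false) → NoConsec (b ∷ w) → NoConsec (a ∷ b ∷ w)
noConsec-cons true  true  w isolated _ with isolated refl
... | ()
noConsec-cons true  false w _ rest = rest
noConsec-cons false b     w _ rest = rest

window-noConsec : ∀ {f} → NoConsecutiveOnes f → ∀ k x → NoConsec (window f k x)
window-noConsec         isolated zero          x = tt
window-noConsec         isolated (suc zero)    x = tt
window-noConsec {f = f} isolated (suc (suc k)) x =
  noConsec-cons (f x) (f (suc x)) (window f k (suc (suc x)))
                (isolated x) (window-noConsec isolated (suc k) (suc x))

-- position of the first 1 of a word (its length if there is none)
firstOne : ∀ {k} → Vec Bool k → ℕ
firstOne []          = 0
firstOne (true ∷ w)  = 0
firstOne (false ∷ w) = suc (firstOne w)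

firstOne-window : ∀ f k x d → d ≤ k → (∀ t → t < d → f (t + x) ≡ false) →
                  (d < k → f (d + x) ≡ true) → firstOne (window f k x) ≡ d
firstOne-window f zero    x zero    _         _     _   = refl
firstOne-window f (suc k) x zero    _         _     one rewrite one (s≤s z≤n) = refl
firstOne-window f (suc k) x (suc d) (s≤s d≤k) zeros one rewrite zeros 0 (s≤s z≤n) =
  cong suc (firstOne-window f k (suc x) d d≤k
             (λ t t<d → trans (shifted f t x) (zeros (suc t) (s≤s t<d)))
             (λ d<k → trans (shifted f d x) (one (s≤s d<k))))

firstOne-bound : ∀ f k x d → d < k → f (d + x) ≡ true → firstOne (window f k x) ≤ d
firstOne-bound f (suc k) x zero    _         one rewrite one = z≤n
firstOne-bound f (suc k) x (suc d) (s≤s d<k) one with f x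
... | true  = z≤n
... | false = s≤s (firstOne-bound f k (suc x) d d<k (trans (shifted f d x) one))

lastOne : ∀ {k} → Vec Bool k → Maybe ℕ
lastOne []      = nothing
lastOne (b ∷ w) = extend b (lastOne w)
  where
  extend : Bool → Maybe ℕ → Maybe ℕ
  extend _     (just q) = just (suc q)
  extend true  nothing  = just 0
  extend false nothing  = nothing

lastOne-none : ∀ f k x → (∀ t → t < k → f (t + x) ≡ false) → lastOne (window f k x) ≡ nothing
lastOne-none f zero    x zeros = refl
lastOne-none f (suc k) x zeros
  rewrite lastOne-none f k (suc x) (λ t t<k → trans (shifted f t x) (zeros (suc t) (s≤s t<k)))
        | zeros 0 (s≤s z≤n) = refl

lastOne-window : ∀ f k x q → q < k → f (q + x) ≡ true →
                 (∀ t → q < t → t < k → f (t + x) ≡ false) → lastOne (window f k x) ≡ just q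
lastOne-window f (suc k) x zero _ one zeros
  rewrite lastOne-none f k (suc x)
            (λ t t<k → trans (shifted f t x) (zeros (suc t) (s≤s z≤n) (s≤s t<k)))
        | one = refl
lastOne-window f (suc k) x (suc q) (s≤s q<k) one zeros
  rewrite lastOne-window f k (suc x) q q<k (trans (shifted f q x) one)
            (λ t q<t t<k → trans (shifted f t x) (zeros (suc t) (s≤s q<t) (s≤s t<k))) = refl

WindowsDistinct : (ℕ → Bool) → ℕ → ℕ → Set
WindowsDistinct f N k = ∀ {i i′} → i < N → i′ < N → window f k i ≡ window f k i′ → i ≡ i′

-- a window of length k is a prefix of the window of length k+1 at the same start
windowsDistinct-suc : ∀ {f N k} → WindowsDistinct f N k → WindowsDistinct f N (suc k)
windowsDistinct-suc {f} {N} {k} distinct {i} {i′} i<N i′<N eq =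
  distinct i<N i′<N (∷ʳ-injectiveˡ (window f k i) (window f k i′)
    (trans (sym (window-snoc f k i)) (trans eq (window-snoc f k i′))))

windowsDistinct-mono : ∀ {f N k k′} → k ≤′ k′ → WindowsDistinct f N k → WindowsDistinct f N k′
windowsDistinct-mono ≤′-refl       distinct = distinct
windowsDistinct-mono (≤′-step k≤k′) distinct = windowsDistinct-suc (windowsDistinct-mono k≤k′ distinct)

Periodic : (ℕ → Bool) → ℕ → Set
Periodic f N = ∀ y → f (N + y) ≡ f y

record CyclicWord (N k : ℕ) : Set where
  field
    letter            : ℕ → Bool
    periodic          : Periodic letter N
    noConsecutiveOnes : NoConsecutiveOnes letter
    windowsDistinct   : WindowsDistinct letter N k

lengthen : ∀ {N k k′} → k ≤ k′ → CyclicWord N k → CyclicWord N k′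
lengthen k≤k′ w = record
  { letter            = letter
  ; periodic          = periodic
  ; noConsecutiveOnes = noConsecutiveOnes
  ; windowsDistinct   = windowsDistinct-mono (≤⇒≤′ k≤k′) windowsDistinct
  }
  where open CyclicWord w

window-successor : ∀ {f N} k → Periodic f (suc N) → ∀ x → x < suc N →
                   window f k (suc x % suc N) ≡ window f k (suc x)
window-successor {f} k periodic x x<N with m≤n⇒m<n∨m≡n x<N
... | inj₁ 1+x<N = cong (window f k) (m<n⇒m%n≡m 1+x<N)
... | inj₂ refl  = trans (cong (window f k) (n%n≡0 (suc x))) (window-cong f k 0 (suc x) wrap)
  where
  wrap : ∀ t → f (t + 0) ≡ f (t + suc x)
  wrap t = trans (cong f (+-identityʳ t)) (sym (trans (cong f (+-comm t (suc x))) (periodic t)))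

cycleOf : ∀ {N k} → CyclicWord (suc N) (suc k) → Cycle (suc k) (suc N)
cycleOf {N} {k} w = record
  { vert = vertex ; nonempty = s≤s z≤n ; distinct = distinct ; arcs = arc }
  where
  open CyclicWord w

  vertex : Fin (suc N) → Vertex (suc k)
  vertex i = window letter (suc k) (toℕ i) , window-noConsec noConsecutiveOnes (suc k) (toℕ i)

  distinct : Injective _≡_ _≡_ vertex
  distinct {i} {i′} eq = toℕ-injective (windowsDistinct (toℕ<n i) (toℕ<n i′) (cong proj₁ eq))

  -- the arc from the window at x to the window at x+1 appends the letter at k+1+x
  arc : ∀ i → Arc (vertex i) (vertex (next i))
  arc i = letter (k + suc x)
        , subst NoConsec (cong (letter x ∷_) (window-snoc letter k (suc x)))
                (window-noConsec noConsecutiveOnes (suc (suc k)) x)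
        , (begin
            window letter (suc k) (toℕ (next i))      ≡⟨ cong (window letter (suc k)) (toℕ-fromℕ< _) ⟩
            window letter (suc k) (suc x % suc N)     ≡⟨ window-successor (suc k) periodic x (toℕ<n i) ⟩
            window letter (suc k) (suc x)             ≡⟨ window-snoc letter k (suc x) ⟩
            window letter k (suc x) ∷ʳ letter (k + suc x) ∎)
    where
    x : ℕ
    x = toℕ i

allZeros : ∀ k → CyclicWord 1 k
allZeros k = record
  { letter            = λ _ → false
  ; periodic          = λ _ → refl
  ; noConsecutiveOnes = λ _ ()
  ; windowsDistinct   = λ { (s≤s z≤n) (s≤s z≤n) _ → refl }
  }

-- doubling, by recursion so that the block (10)^j 1 can be analysed by induction on j
double : ℕ → ℕ
double zero    = zero
double (suc c) = suc (suc (double c))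

-- alternating j y: the y-th letter of (10)^j 1 0 0 …, i.e. y is even and y ≤ 2j
alternating : ℕ → ℕ → Bool
alternating j       zero          = true
alternating zero    (suc y)       = false
alternating (suc j) (suc zero)    = false
alternating (suc j) (suc (suc y)) = alternating j y

alternating-last : ∀ j → alternating j (double j) ≡ true
alternating-last zero    = refl
alternating-last (suc j) = alternating-last j

alternating-beyond : ∀ j y → double j < y → alternating j y ≡ false
alternating-beyond zero    (suc y)       _                 = refl
alternating-beyond (suc j) (suc (suc y)) (s≤s (s≤s 2j<y)) = alternating-beyond j y 2j<y

alternating-bounded : ∀ j y → alternating j y ≡ true → y ≤ double j
alternating-bounded j       zero          _   = z≤n
alternating-bounded (suc j) (suc (suc y)) one = s≤s (s≤s (alternating-bounded j y one))

alternating-isolated : ∀ j y → alternating j y ≡ true → alternating j (suc y) ≡ false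
alternating-isolated zero    zero          _   = refl
alternating-isolated (suc j) zero          _   = refl
alternating-isolated (suc j) (suc (suc y)) one = alternating-isolated j y one

alternating-near : ∀ j y → y ≤ double j → alternating j y ≡ true ⊎ alternating j (suc y) ≡ true
alternating-near j       zero          _                 = inj₁ refl
alternating-near (suc j) (suc zero)    _                 = inj₂ refl
alternating-near (suc j) (suc (suc y)) (s≤s (s≤s y≤2j)) = alternating-near j y y≤2j

module Necklace (j m : ℕ) where

  J : ℕ
  J = double j

  N : ℕ
  N = suc J + suc m

  S : ℕ → Bool
  S y = alternating j (y % N)

  plusN-mod : ∀ y → (N + y) % N ≡ y % N
  plusN-mod y = trans (cong (_% N) (+-comm N y)) ([m+n]%n≡m%n y N)

  S-periodic : Periodic S N
  S-periodic y = cong (alternating j) (plusN-mod y)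

  S-below : ∀ {y} → y < N → S y ≡ alternating j y
  S-below y<N = cong (alternating j) (m<n⇒m%n≡m y<N)

  S-wrap : ∀ {y} → y < N → S (N + y) ≡ alternating j y
  S-wrap {y} y<N = trans (S-periodic y) (S-below y<N)

  S-N : S N ≡ true
  S-N = cong (alternating j) (n%n≡0 N)

  S-gap : ∀ {y} → J < y → y < N → S y ≡ false
  S-gap {y} J<y y<N = trans (S-below y<N) (alternating-beyond j y J<y)

  J<N : J < N
  J<N = s≤s (m≤m+n J (suc m))

  -- a 1 is followed inside the same period, and its successor there is a 0
  S-noConsec : NoConsecutiveOnes S
  S-noConsec y one = trans (cong (alternating j) next-mod) (alternating-isolated j (y % N) one)
    where
    r<N : suc (y % N) < N
    r<N = s≤s (≤-trans (s≤s (alternating-bounded j (y % N) one)) (m<m+n J (s≤s z≤n)))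
    next-mod : suc y % N ≡ suc (y % N)
    next-mod = begin
      suc y % N                       ≡⟨ cong (λ z → suc z % N) (m≡m%n+[m/n]*n y N) ⟩
      (suc (y % N) + y / N * N) % N   ≡⟨ [m+kn]%n≡m%n (suc (y % N)) (y / N) N ⟩
      suc (y % N) % N                 ≡⟨ m<n⇒m%n≡m r<N ⟩
      suc (y % N)                     ∎

  -- recover the start of a window from the positions of its first and last 1:
  -- a first 1 at distance d ≥ 2 is the 1 at position N, otherwise the last 1
  -- at position q is the 1 at cyclic position J
  locate : ℕ → Maybe ℕ → ℕ
  locate (suc (suc d)) _        = N ∸ suc (suc d)
  locate _             (just q) = (N + J ∸ q) % N
  locate _             nothing  = 0

  locate-far : ∀ {d} l → 2 ≤ d → locate d l ≡ N ∸ d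
  locate-far l (s≤s (s≤s _)) = refl

  locate-near : ∀ {d} q → d ≤ 1 → locate d (just q) ≡ (N + J ∸ q) % N
  locate-near q z≤n       = refl
  locate-near q (s≤s z≤n) = refl

  module Windows (k : ℕ) (m<k : m < k) (k≤m+2 : k ≤ suc (suc m)) (J+2≤k : suc (suc J) ≤ k) where

    J<k : J < k
    J<k = ≤-trans (n≤1+n (suc J)) J+2≤k

    inside : ∀ {t i} → t < k → i ≤ J → t + i < N
    inside {t} {i} t<k i≤J =
      s≤s (≤-trans (+-mono-≤ (s≤s⁻¹ (≤-trans t<k k≤m+2)) i≤J) (≤-reflexive (+-comm (suc m) J)))

    -- windows starting at i ≤ J: the last 1 is the one at J
    locate-block : ∀ {i} → i ≤ J → locate (firstOne (window S k i)) (lastOne (window S k i)) ≡ i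
    locate-block {i} i≤J = begin
      locate (firstOne w) (lastOne w)      ≡⟨ cong (locate (firstOne w)) last ⟩
      locate (firstOne w) (just (J ∸ i))   ≡⟨ locate-near (J ∸ i) first≤1 ⟩
      (N + J ∸ (J ∸ i)) % N                ≡⟨ cong (_% N) (+-∸-assoc N (m∸n≤m J i)) ⟩
      (N + (J ∸ (J ∸ i))) % N              ≡⟨ cong (λ z → (N + z) % N) (m∸[m∸n]≡n i≤J) ⟩
      (N + i) % N                          ≡⟨ plusN-mod i ⟩
      i % N                                ≡⟨ m<n⇒m%n≡m (≤-<-trans i≤J J<N) ⟩
      i                                    ∎
      where
      w : Vec Bool k
      w = window S k i
      first≤1 : firstOne w ≤ 1
      first≤1 with alternating-near j i i≤J
      ... | inj₁ one = ≤-trans (firstOne-bound S k i 0 (≤-trans (s≤s z≤n) m<k)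
                                  (trans (S-below (≤-<-trans i≤J J<N)) one)) z≤n
      ... | inj₂ one = firstOne-bound S k i 1 (≤-trans (s≤s (s≤s z≤n)) J+2≤k)
                         (trans (S-below (s≤s (≤-trans (s≤s i≤J) (m<m+n J (s≤s z≤n))))) one)
      last : lastOne w ≡ just (J ∸ i)
      last = lastOne-window S k i (J ∸ i) (≤-<-trans (m∸n≤m J i) J<k)
               (trans (cong S (m∸n+n≡m i≤J)) (trans (S-below J<N) (alternating-last j)))
               (λ t q<t t<k → S-gap (subst (_≤ t + i) (cong suc (m∸n+n≡m i≤J)) (+-monoˡ-≤ i q<t))
                                    (inside t<k i≤J))

    -- windows starting in the zero block before N-1: the first 1 is the one at N
    locate-gap : ∀ {i} → J < i → suc i < N → locate (firstOne (window S k i)) (lastOne (window S k i)) ≡ i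
    locate-gap {i} J<i 1+i<N = begin
      locate (firstOne w) (lastOne w)  ≡⟨ cong (λ d → locate d (lastOne w)) first ⟩
      locate (N ∸ i) (lastOne w)       ≡⟨ locate-far (lastOne w) 2≤N∸i ⟩
      N ∸ (N ∸ i)                      ≡⟨ m∸[m∸n]≡n (<⇒≤ i<N) ⟩
      i                                ∎
      where
      w : Vec Bool k
      w = window S k i
      i<N : i < N
      i<N = <-trans (n<1+n i) 1+i<N
      2≤N∸i : 2 ≤ N ∸ i
      2≤N∸i = ≤-trans (≤-reflexive (sym (m+n∸n≡m 2 i))) (∸-monoˡ-≤ i 1+i<N)
      N∸i≤k : N ∸ i ≤ k
      N∸i≤k = ≤-trans (∸-monoʳ-≤ N J<i) (≤-trans (≤-reflexive (m+n∸m≡n (suc J) (suc m))) m<k)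
      first : firstOne w ≡ N ∸ i
      first = firstOne-window S k i (N ∸ i) N∸i≤k
                (λ t t<d → S-gap (≤-trans J<i (m≤n+m i t))
                                 (subst (t + i <_) (m∸n+n≡m (<⇒≤ i<N)) (+-monoˡ-< i t<d)))
                (λ _ → trans (cong S (m∸n+n≡m (<⇒≤ i<N))) S-N)

    -- the window starting at N-1 reads 0 1 0 1 … 0 1 0 …: its last 1 is at N+J
    locate-end : locate (firstOne (window S k (J + suc m))) (lastOne (window S k (J + suc m))) ≡ J + suc m
    locate-end = begin
      locate (firstOne w) (lastOne w)  ≡⟨ cong₂ locate first last ⟩
      (N + J ∸ suc J) % N              ≡⟨ cong (_% N) (m+n∸n≡m i J) ⟩
      i % N                            ≡⟨ m<n⇒m%n≡m (n<1+n i) ⟩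
      i                                ∎
      where
      i : ℕ
      i = J + suc m
      w : Vec Bool k
      w = window S k i
      after : ∀ t → t < N → S (suc t + i) ≡ alternating j t
      after t t<N = trans (cong (λ z → S (suc z)) (+-comm t i)) (S-wrap t<N)
      first : firstOne w ≡ 1
      first = firstOne-window S k i 1 (≤-trans (s≤s z≤n) m<k)
                (λ { zero _ → S-gap (m<m+n J (s≤s z≤n)) (n<1+n i) ; (suc t) (s≤s ()) })
                (λ _ → S-N)
      last : lastOne w ≡ just (suc J)
      last = lastOne-window S k i (suc J) J+2≤k
               (trans (after J J<N) (alternating-last j))
               (λ { (suc t) (s≤s J<t) t<k → trans (after t (<-trans (s≤s⁻¹ (≤-trans t<k k≤m+2))
                                                                     (s≤s (m≤n+m (suc m) J))))
                                                  (alternating-beyond j t J<t) })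

    -- every window of the necklace is located correctly, so its N windows are distinct
    locate-window : ∀ {i} → i < N → locate (firstOne (window S k i)) (lastOne (window S k i)) ≡ i
    locate-window {i} i<N with i ≤? J
    ... | yes i≤J = locate-block i≤J
    ... | no  i≰J with m≤n⇒m<n∨m≡n (s≤s⁻¹ i<N)
    ...   | inj₁ i<N-1 = locate-gap (≰⇒> i≰J) (s≤s i<N-1)
    ...   | inj₂ refl  = locate-end

    necklace : CyclicWord N k
    necklace = record
      { letter            = S
      ; periodic          = S-periodic
      ; noConsecutiveOnes = S-noConsec
      ; windowsDistinct   = λ {i} {i′} i<N i′<N eq →
          trans (sym (locate-window i<N))
                (trans (cong (λ v → locate (firstOne v) (lastOne v)) eq) (locate-window i′<N))
      }

open Necklace.Windows using (necklace)

-- every length 2 ≤ n occurs with windows of length n (j = 0, m = n - 2)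
shortWord : ∀ n → CyclicWord (suc (suc n)) (suc (suc n))
shortWord n = necklace 0 n (suc (suc n)) (n≤1+n (suc n)) ≤-refl (s≤s (s≤s z≤n))

data EvenOdd : ℕ → Set where
  even : ∀ c → EvenOdd (double c)
  odd  : ∀ c → EvenOdd (suc (double c))

evenOdd : ∀ n → EvenOdd n
evenOdd zero          = even 0
evenOdd (suc zero)    = odd 0
evenOdd (suc (suc n)) with evenOdd n
... | even c = even (suc c)
... | odd  c = odd (suc c)

double≡*2 : ∀ c → double c ≡ c * 2
double≡*2 zero    = refl
double≡*2 (suc c) = cong (λ z → suc (suc z)) (double≡*2 c)

double-%2 : ∀ c → double c % 2 ≡ 0
double-%2 c = trans (cong (_% 2) (double≡*2 c)) (m*n%n≡0 c 2)

suc-double-%2 : ∀ c → suc (double c) % 2 ≡ 1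
suc-double-%2 c = trans (cong (λ z → suc z % 2) (double≡*2 c)) ([m+kn]%n≡m%n 1 c 2)

double-≤-odd : ∀ {a b} → double a ≤ suc (double b) → double a ≤ double b
double-≤-odd {zero}          _               = z≤n
double-≤-odd {suc a} {suc b} (s≤s (s≤s 2a≤)) = s≤s (s≤s (double-≤-odd 2a≤))

ell-excess : ∀ k₂ → Σ ℕ λ c → double c ≤ k₂ × ell (suc (suc k₂)) ≡ suc (double c) + suc (suc k₂)
ell-excess k₂ with evenOdd k₂
... | even c rewrite double-%2 (suc c) =
  c , ≤-refl , cong (λ z → suc (double c + z)) (+-identityʳ (double (suc c)))
... | odd c rewrite suc-double-%2 (suc c) =
  c , n≤1+n (double c) , cong (λ z → suc (double c + z)) (+-identityʳ (suc (double (suc c))))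

-- every length k ≤ n ≤ ℓ occurs with windows of length k: n - k = 2j or 2j+1
longWord : ∀ k₂ n → suc (suc k₂) ≤ n → n ≤ ell (suc (suc k₂)) → CyclicWord n (suc (suc k₂))
longWord k₂ n k≤n n≤ℓ with ell-excess k₂
... | c , 2c≤k₂ , ℓ≡ = fromExcess (n ∸ k) excess≤ (m∸n+n≡m k≤n)
  where
  k : ℕ
  k = suc (suc k₂)

  excess≤ : n ∸ k ≤ suc (double c)
  excess≤ = ≤-trans (∸-monoˡ-≤ k (≤-trans n≤ℓ (≤-reflexive ℓ≡))) (≤-reflexive (m+n∸n≡m _ k))

  fromExcess : ∀ r → r ≤ suc (double c) → r + k ≡ n → CyclicWord n k
  fromExcess r r≤ n≡ with evenOdd r
  ... | even i = subst (λ N → CyclicWord N k) (trans (sym (+-suc (double i) (suc k₂))) n≡)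
                   (necklace i k₂ k (n≤1+n _) ≤-refl (s≤s (s≤s (≤-trans (double-≤-odd r≤) 2c≤k₂))))
  ... | odd i  = subst (λ N → CyclicWord N k) n≡
                   (necklace i (suc k₂) k ≤-refl (n≤1+n _) (s≤s (s≤s (≤-trans (s≤s⁻¹ r≤) 2c≤k₂))))

proposition3p1 : (k : ℕ) → 2 ≤ k → (n : ℕ) → 1 ≤ n → n ≤ ell k → Cycle k n
proposition3p1 (suc (suc k₂)) _ (suc n) _ n≤ℓ = cycleOf (word n n≤ℓ)
  where
  word : ∀ n → suc n ≤ ell (suc (suc k₂)) → CyclicWord (suc n) (suc (suc k₂))
  word zero     _   = allZeros (suc (suc k₂))
  word (suc n₂) n≤ℓ with ≤-total (suc (suc n₂)) (suc (suc k₂))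
  ... | inj₁ n≤k = lengthen n≤k (shortWord n₂)
  ... | inj₂ k≤n = longWord k₂ (suc (suc n₂)) k≤n n≤ℓ
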